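{- $F_0^I(x,y,q)=1$, $F_1^I(x,y,q)=x$, and for $n\geq 2$, $$F_n^I(x,y,q)=xq^{n-1}F_{n-1}^I(x,y,q)+yq^{2(n-2)}F_{n-2}^I(x,y,q).$$
   Context: $S_n(123,132,213)$ denotes the set of permutations of $[n]=\{1,\dots,n\}$ containing no subsequence order isomorphic to $123$, $132$ or $213$. For a permutation $\pi$, split $\pi$ into its maximal increasing runs of consecutive entries (for $\pi\in S_n(123,132,213)$ these are the layers of $\pi$, which is a reverse layered matching: a concatenation of increasing blocks of size $1$ or $2$, each block larger than all later blocks). Let $s(\pi)$ be the number of such runs of length $1$ (singletons) and $d(\pi)$ the number of length $2$ (doubletons). $inv(\pi)$ is the number of pairs $i<j$ with $p_i>p_j$. Define $F_n^I(x,y,q)=\sum_{\pi\in S_n(123,132,213)}x^{s(\pi)}y^{d(\pi)}q^{inv(\pi)}$. -}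

module Defs where

open import Level using (Level)
open import Data.Nat using (ℕ; zero; suc; _<ᵇ_; _≡ᵇ_)
open import Data.Bool using (Bool; true; false; if_then_else_; _∧_; _∨_; not)
open import Data.List using (List; []; _∷_; map; concatMap; filter; length; foldr; upTo)
open import Data.Product using (_×_; _,_)
open import Algebra.Bundles using (CommutativeSemiring)

-- Permutations of [n] = {1,...,n} are represented in one-line notation as lists.

insertions : ℕ → List ℕ → List (List ℕ)
insertions a [] = (a ∷ []) ∷ []
insertions a (b ∷ bs) = (a ∷ b ∷ bs) ∷ map (b ∷_) (insertions a bs)

perms : List ℕ → List (List ℕ)
perms [] = [] ∷ []
perms (a ∷ as) = concatMap (insertions a) (perms as)

range1 : ℕ → List ℕ
range1 n = map suc (upTo n)

Sn : ℕ → List (List ℕ)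
Sn n = perms (range1 n)

pairsWith : ℕ → List ℕ → List (ℕ × ℕ)
pairsWith a [] = []
pairsWith a (b ∷ bs) = (a , b) ∷ pairsWith a bs

pairs : List ℕ → List (ℕ × ℕ)
pairs [] = []
pairs (a ∷ as) = foldr (λ p r → p ∷ r) (pairs as) (pairsWith a as)

triples : List ℕ → List (ℕ × ℕ × ℕ)
triples [] = []
triples (a ∷ as) = foldr (λ p r → p ∷ r) (triples as)
                     (map (λ { (b , c) → (a , b , c) }) (pairs as))

is123 is132 is213 : ℕ × ℕ × ℕ → Bool
is123 (a , b , c) = (a <ᵇ b) ∧ (b <ᵇ c)
is132 (a , b , c) = (a <ᵇ c) ∧ (c <ᵇ b)
is213 (a , b , c) = (b <ᵇ a) ∧ (a <ᵇ c)

avoids : List ℕ → Bool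
avoids π = foldr (λ t r → not (is123 t ∨ is132 t ∨ is213 t) ∧ r) true (triples π)

Sn-avoid : ℕ → List (List ℕ)
Sn-avoid n = filter (λ π → Data.Bool.T? (avoids π)) (Sn n)
  where import Data.Bool

runsFrom : ℕ → List ℕ → ℕ → List ℕ
runsFrom prev [] k = k ∷ []
runsFrom prev (b ∷ l) k = if prev <ᵇ b then runsFrom b l (suc k) else k ∷ runsFrom b l 1

runLengths : List ℕ → List ℕ
runLengths [] = []
runLengths (a ∷ l) = runsFrom a l 1

countB : List Bool → ℕ
countB = foldr (λ b r → if b then suc r else r) 0

s d : List ℕ → ℕ
s π = countB (map (_≡ᵇ 1) (runLengths π))
d π = countB (map (_≡ᵇ 2) (runLengths π))

inv : List ℕ → ℕ
inv π = countB (map (λ { (a , b) → b <ᵇ a }) (pairs π))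

module _ {c ℓ : Level} (R : CommutativeSemiring c ℓ) where
  open CommutativeSemiring R

  pow : Carrier → ℕ → Carrier
  pow z zero = 1#
  pow z (suc n) = z * pow z n

  -- F_n^I(x,y,q) evaluated in R
  -- (a polynomial identity with ℕ coefficients holds iff it holds in every commutative semiring)
  F : Carrier → Carrier → Carrier → ℕ → Carrier
  F x y q n = foldr (λ π r → (pow x (s π) * pow y (d π)) * pow q (inv π) + r) 0#
                    (Sn-avoid n)

-- A triple of distinct values is order isomorphic to 123, 132 or 213 exactly when its first entry
-- is smaller than its last, so the avoiders are the permutations with π(i) > π(k) whenever
-- k ≥ i + 2. S_n is generated by inserting 1 into the permutations of {2,…,n}, which are generated
-- by inserting 2 into the permutations of {3,…,n}. Inserting the smallest entry 1 into σ can give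
-- an avoider only at the end, which appends a singleton layer to σ, or just before the last entry
-- of σ; in the second case that last entry must be 2, inserted at the end of some τ, so a
-- doubleton layer is appended to τ. Appending a layer below all other entries adds
-- (length of the layer) · (length of the rest) inversions, whence the powers of q.

module Submission where

open import Defs
open import Level using (Level)
open import Data.Nat using (ℕ; suc)
open import Data.Product using (_×_; _,_)
open import Algebra.Bundles using (CommutativeSemiring)

module Patterns where
  open import Data.Nat using (_+_; _*_; _<_; _<ᵇ_; _≡ᵇ_; s<s)
  open import Data.Nat.Properties using (<ᵇ⇒<; <⇒<ᵇ; <-trans; <-asym; <-cmp; <⇒≢; +-identityʳ)
  open import Data.Nat.Tactic.RingSolver using (solve-∀)
  open import Data.Bool using (Bool; true; false; not; _∧_; _∨_)
  open import Data.Bool.Properties using (∧-assoc; ∧-zeroʳ; ∧-identityʳ; T-≡)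
  open import Data.Bool.ListAction using (all)
  open import Data.List using (List; []; _∷_; _++_; map; foldr; length; upTo)
  open import Data.List.Properties
    using (++-is-foldr; foldr-map; map-∘; map-++; ++-identityʳ; length-map; length-upTo)
  open import Data.List.Relation.Unary.All as All using (All; []; _∷_)
  import Data.List.Relation.Unary.All.Properties as All
  open import Data.List.Relation.Unary.AllPairs using (AllPairs)
  import Data.List.Relation.Unary.AllPairs.Properties as AllPairs
  open import Data.List.Relation.Unary.Unique.Propositional using (Unique)
  open import Data.List.Relation.Binary.Permutation.Propositional
    using (_↭_; ↭-refl; ↭-prep; ↭-swap; ↭-trans; ↭⇒↭ₛ)
  import Data.List.Relation.Binary.Permutation.Setoid.Properties as Permutationₛ
  open import Function using (_∘_; Equivalence)
  open import Relation.Binary.Definitions using (tri<; tri≈; tri>)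
  open import Relation.Binary.PropositionalEquality
  open import Relation.Nullary using (contradiction)

  <ᵇ-true : ∀ {m n} → m < n → (m <ᵇ n) ≡ true
  <ᵇ-true m<n = Equivalence.to T-≡ (<⇒<ᵇ m<n)

  <ᵇ-false : ∀ {m n} → n < m → (m <ᵇ n) ≡ false
  <ᵇ-false {m} {n} n<m with m <ᵇ n | <ᵇ⇒< m n
  ... | false | _   = refl
  ... | true  | m<n = contradiction (m<n _) (<-asym n<m)

  allowed : ℕ × ℕ × ℕ → Bool
  allowed t = not (is123 t ∨ is132 t ∨ is213 t)

  allowed-last< : ∀ {a b c} → c < a → allowed (a , b , c) ≡ true
  allowed-last< {a} {b} {c} c<a rewrite <ᵇ-false c<a | ∧-zeroʳ (b <ᵇ a)
    with a <ᵇ b | <ᵇ⇒< a b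
  ... | false | _   = refl
  ... | true  | a<b rewrite <ᵇ-false (<-trans c<a (a<b _)) = refl

  allowed-first<last : ∀ {a b c} → a < c → b ≢ a → b ≢ c → allowed (a , b , c) ≡ false
  allowed-first<last {a} {b} {c} a<c b≢a b≢c rewrite <ᵇ-true a<c with <-cmp b a
  ... | tri≈ _ b≡a _ = contradiction b≡a b≢a
  ... | tri< b<a _ _ rewrite <ᵇ-false b<a | <ᵇ-true b<a | <ᵇ-false (<-trans b<a a<c) = refl
  ... | tri> _ _ a<b with <-cmp b c
  ...   | tri< b<c _ _ rewrite <ᵇ-true a<b | <ᵇ-true b<c = refl
  ...   | tri≈ _ b≡c _ = contradiction b≡c b≢c
  ...   | tri> _ _ c<b rewrite <ᵇ-true a<b | <ᵇ-false c<b | <ᵇ-true c<b = refl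

  pairs-∷ : ∀ u l → pairs (u ∷ l) ≡ map (u ,_) l ++ pairs l
  pairs-∷ u l = trans (sym (++-is-foldr (pairsWith u l) (pairs l))) (cong (_++ pairs l) (pairsWith≡map l))
    where
    pairsWith≡map : ∀ l → pairsWith u l ≡ map (u ,_) l
    pairsWith≡map []      = refl
    pairsWith≡map (v ∷ l) = cong ((u , v) ∷_) (pairsWith≡map l)

  triples-∷ : ∀ c l → triples (c ∷ l) ≡ map (c ,_) (pairs l) ++ triples l
  triples-∷ c l = sym (++-is-foldr (map (c ,_) (pairs l)) (triples l))

  all-++ : ∀ {A : Set} (f : A → Bool) xs ys → all f (xs ++ ys) ≡ all f xs ∧ all f ys
  all-++ f []       ys = refl
  all-++ f (x ∷ xs) ys = trans (cong (f x ∧_) (all-++ f xs ys)) (sym (∧-assoc (f x) _ _))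

  all-map : ∀ {A B : Set} (f : B → Bool) (g : A → B) xs → all f (map g xs) ≡ all (f ∘ g) xs
  all-map f g xs = cong (foldr _∧_ true) (sym (map-∘ xs))

  avoids-all : ∀ π → avoids π ≡ all allowed (triples π)
  avoids-all π = sym (foldr-map _∧_ allowed true (triples π))

  avoidsFrom : ℕ → List ℕ → Bool
  avoidsFrom c l = all (allowed ∘ (c ,_)) (pairs l)

  avoids-∷ : ∀ c l → avoids (c ∷ l) ≡ avoidsFrom c l ∧ avoids l
  avoids-∷ c l = begin
    avoids (c ∷ l)
      ≡⟨ avoids-all (c ∷ l) ⟩
    all allowed (triples (c ∷ l))
      ≡⟨ cong (all allowed) (triples-∷ c l) ⟩
    all allowed (map (c ,_) (pairs l) ++ triples l)
      ≡⟨ all-++ allowed (map (c ,_) (pairs l)) (triples l) ⟩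
    all allowed (map (c ,_) (pairs l)) ∧ all allowed (triples l)
      ≡⟨ cong₂ _∧_ (all-map allowed (c ,_) (pairs l)) (sym (avoids-all l)) ⟩
    avoidsFrom c l ∧ avoids l ∎
    where open ≡-Reasoning

  avoidsFrom-∷ : ∀ c u l → avoidsFrom c (u ∷ l) ≡ all (λ v → allowed (c , u , v)) l ∧ avoidsFrom c l
  avoidsFrom-∷ c u l = begin
    avoidsFrom c (u ∷ l)
      ≡⟨ cong (all (allowed ∘ (c ,_))) (pairs-∷ u l) ⟩
    all (allowed ∘ (c ,_)) (map (u ,_) l ++ pairs l)
      ≡⟨ all-++ (allowed ∘ (c ,_)) (map (u ,_) l) (pairs l) ⟩
    all (allowed ∘ (c ,_)) (map (u ,_) l) ∧ avoidsFrom c l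
      ≡⟨ cong (_∧ avoidsFrom c l) (all-map (allowed ∘ (c ,_)) (u ,_) l) ⟩
    all (λ v → allowed (c , u , v)) l ∧ avoidsFrom c l ∎
    where open ≡-Reasoning

  avoids-∷-false : ∀ c w → avoids w ≡ false → avoids (c ∷ w) ≡ false
  avoids-∷-false c w w✗ = trans (avoids-∷ c w) (trans (cong (avoidsFrom c w ∧_) w✗) (∧-zeroʳ _))

  -- xs ++ ys is then the skew sum of xs and ys
  _≻_ : List ℕ → List ℕ → Set
  xs ≻ ys = All (λ u → All (_< u) ys) xs

  all-allowed-below : ∀ {c} u {l} → All (_< c) l → all (λ v → allowed (c , u , v)) l ≡ true
  all-allowed-below u []           = refl
  all-allowed-below u (v<c ∷ l<c) = cong₂ _∧_ (allowed-last< {b = u} v<c) (all-allowed-below u l<c)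

  avoidsFrom-below : ∀ {c l} → All (_< c) l → avoidsFrom c l ≡ true
  avoidsFrom-below {c} {[]}    []         = refl
  avoidsFrom-below {c} {u ∷ l} (_ ∷ l<c) =
    trans (avoidsFrom-∷ c u l) (cong₂ _∧_ (all-allowed-below u l<c) (avoidsFrom-below l<c))

  avoidsFrom-++ : ∀ {c} l {ys} → All (_< c) ys → avoidsFrom c (l ++ ys) ≡ avoidsFrom c l
  avoidsFrom-++ []      ys<c = avoidsFrom-below ys<c
  avoidsFrom-++ {c} (u ∷ l) {ys} ys<c = begin
    avoidsFrom c (u ∷ l ++ ys)
      ≡⟨ avoidsFrom-∷ c u (l ++ ys) ⟩
    all (allowed₃ u) (l ++ ys) ∧ avoidsFrom c (l ++ ys)
      ≡⟨ cong₂ _∧_ (all-++ (allowed₃ u) l ys) (avoidsFrom-++ l ys<c) ⟩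
    (all (allowed₃ u) l ∧ all (allowed₃ u) ys) ∧ avoidsFrom c l
      ≡⟨ cong (λ b → (all (allowed₃ u) l ∧ b) ∧ avoidsFrom c l) (all-allowed-below u ys<c) ⟩
    (all (allowed₃ u) l ∧ true) ∧ avoidsFrom c l
      ≡⟨ cong (_∧ avoidsFrom c l) (∧-identityʳ _) ⟩
    all (allowed₃ u) l ∧ avoidsFrom c l
      ≡⟨ avoidsFrom-∷ c u l ⟨
    avoidsFrom c (u ∷ l) ∎
    where
    open ≡-Reasoning
    allowed₃ : ℕ → ℕ → Bool
    allowed₃ u v = allowed (c , u , v)

  avoids-++ : ∀ xs {ys} → xs ≻ ys → avoids (xs ++ ys) ≡ avoids xs ∧ avoids ys
  avoids-++ []       _                    = refl
  avoids-++ (c ∷ xs) {ys} (ys<c ∷ xs≻ys) = begin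
    avoids (c ∷ xs ++ ys)
      ≡⟨ avoids-∷ c (xs ++ ys) ⟩
    avoidsFrom c (xs ++ ys) ∧ avoids (xs ++ ys)
      ≡⟨ cong₂ _∧_ (avoidsFrom-++ xs ys<c) (avoids-++ xs xs≻ys) ⟩
    avoidsFrom c xs ∧ (avoids xs ∧ avoids ys)
      ≡⟨ ∧-assoc (avoidsFrom c xs) (avoids xs) (avoids ys) ⟨
    (avoidsFrom c xs ∧ avoids xs) ∧ avoids ys
      ≡⟨ cong (_∧ avoids ys) (avoids-∷ c xs) ⟨
    avoids (c ∷ xs) ∧ avoids ys ∎
    where open ≡-Reasoning

  avoids-123-or-132 : ∀ {a c d} r → a < c → a < d → c ≢ d → avoids (a ∷ c ∷ d ∷ r) ≡ false
  avoids-123-or-132 {a} {c} {d} r a<c a<d c≢d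
    rewrite avoids-∷ a (c ∷ d ∷ r) | avoidsFrom-∷ a c (d ∷ r)
          | allowed-first<last a<d (≢-sym (<⇒≢ a<c)) c≢d = refl

  insertBeforeLast : ℕ → List ℕ → List ℕ
  insertBeforeLast a []          = a ∷ []
  insertBeforeLast a (c ∷ [])    = a ∷ c ∷ []
  insertBeforeLast a (c ∷ d ∷ r) = c ∷ insertBeforeLast a (d ∷ r)

  -- b, a and the last entry form a 213
  avoids-insertBeforeLast : ∀ {a b c} r → a < b → All (b <_) (c ∷ r) →
    avoids (b ∷ insertBeforeLast a (c ∷ r)) ≡ false
  avoids-insertBeforeLast {a} {b} {c} r a<b b<cr =
    trans (avoids-∷ b (insertBeforeLast a (c ∷ r)))
          (cong (_∧ avoids (insertBeforeLast a (c ∷ r))) (avoidsFrom-false r b<cr))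
    where
    avoidsFrom-false : ∀ {c} r → All (b <_) (c ∷ r) → avoidsFrom b (insertBeforeLast a (c ∷ r)) ≡ false
    avoidsFrom-false {c} [] (b<c ∷ [])
      rewrite avoidsFrom-∷ b a (c ∷ [])
            | allowed-first<last b<c (<⇒≢ a<b) (<⇒≢ (<-trans a<b b<c)) = refl
    avoidsFrom-false {c} (d ∷ r) (_ ∷ b<dr) =
      trans (avoidsFrom-∷ b c w)
            (trans (cong (all (λ v → allowed (b , c , v)) w ∧_) (avoidsFrom-false r b<dr)) (∧-zeroʳ _))
      where
      w : List ℕ
      w = insertBeforeLast a (d ∷ r)

  countB-++ : ∀ xs ys → countB (xs ++ ys) ≡ countB xs + countB ys
  countB-++ []           ys = refl
  countB-++ (true  ∷ xs) ys = cong suc (countB-++ xs ys)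
  countB-++ (false ∷ xs) ys = countB-++ xs ys

  countB-map-true : ∀ {A : Set} {f : A → Bool} {l} → All (λ v → f v ≡ true) l →
    countB (map f l) ≡ length l
  countB-map-true []        = refl
  countB-map-true (fv ∷ fl) rewrite fv = cong suc (countB-map-true fl)

  runsFrom-++ : ∀ {b} p l m k → All (b <_) (p ∷ l) →
    runsFrom p (l ++ b ∷ m) k ≡ runsFrom p l k ++ runsFrom b m 1
  runsFrom-++ p []      m k (b<p ∷ []) rewrite <ᵇ-false b<p = refl
  runsFrom-++ p (u ∷ l) m k (_ ∷ b<ul) with p <ᵇ u
  ... | true  = runsFrom-++ u l m (suc k) b<ul
  ... | false = cong (k ∷_) (runsFrom-++ u l m 1 b<ul)

  runLengths-++ : ∀ xs ys → xs ≻ ys → runLengths (xs ++ ys) ≡ runLengths xs ++ runLengths ys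
  runLengths-++ []      ys      _ = refl
  runLengths-++ (c ∷ l) []      _ =
    trans (cong (λ l → runsFrom c l 1) (++-identityʳ l)) (sym (++-identityʳ _))
  runLengths-++ (c ∷ l) (b ∷ m) ((b<c ∷ _) ∷ l≻bm) =
    runsFrom-++ c l m 1 (b<c ∷ All.map All.head l≻bm)

  runCount-++ : ∀ (f : ℕ → Bool) xs ys → xs ≻ ys →
    countB (map f (runLengths (xs ++ ys)))
      ≡ countB (map f (runLengths xs)) + countB (map f (runLengths ys))
  runCount-++ f xs ys xs≻ys =
    trans (cong (countB ∘ map f) (runLengths-++ xs ys xs≻ys))
          (trans (cong countB (map-++ f (runLengths xs) (runLengths ys)))
                 (countB-++ (map f (runLengths xs)) (map f (runLengths ys))))

  s-++ : ∀ xs ys → xs ≻ ys → s (xs ++ ys) ≡ s xs + s ys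
  s-++ = runCount-++ (_≡ᵇ 1)

  d-++ : ∀ xs ys → xs ≻ ys → d (xs ++ ys) ≡ d xs + d ys
  d-++ = runCount-++ (_≡ᵇ 2)

  inv-∷ : ∀ c l → inv (c ∷ l) ≡ countB (map (_<ᵇ c) l) + inv l
  inv-∷ c l = begin
    inv (c ∷ l)
      ≡⟨ cong (countB ∘ map inverted) (pairs-∷ c l) ⟩
    countB (map inverted (map (c ,_) l ++ pairs l))
      ≡⟨ cong countB (map-++ inverted (map (c ,_) l) (pairs l)) ⟩
    countB (map inverted (map (c ,_) l) ++ map inverted (pairs l))
      ≡⟨ countB-++ (map inverted (map (c ,_) l)) (map inverted (pairs l)) ⟩
    countB (map inverted (map (c ,_) l)) + inv l
      ≡⟨ cong (λ bs → countB bs + inv l) (map-∘ l) ⟨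
    countB (map (_<ᵇ c) l) + inv l ∎
    where
    open ≡-Reasoning
    inverted : ℕ × ℕ → Bool
    inverted (u , v) = v <ᵇ u

  inv-++ : ∀ xs ys → xs ≻ ys → inv (xs ++ ys) ≡ inv xs + inv ys + length xs * length ys
  inv-++ []      ys _ = sym (+-identityʳ (inv ys))
  inv-++ (c ∷ l) ys (ys<c ∷ l≻ys) = begin
    inv (c ∷ l ++ ys)
      ≡⟨ inv-∷ c (l ++ ys) ⟩
    countB (map (_<ᵇ c) (l ++ ys)) + inv (l ++ ys)
      ≡⟨ cong₂ _+_ below-c (inv-++ l ys l≻ys) ⟩
    (C + length ys) + (inv l + inv ys + length l * length ys)
      ≡⟨ rearrange C (length ys) (inv l) (inv ys) (length l) ⟩
    (C + inv l) + inv ys + suc (length l) * length ys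
      ≡⟨ cong (λ i → i + inv ys + suc (length l) * length ys) (inv-∷ c l) ⟨
    inv (c ∷ l) + inv ys + length (c ∷ l) * length ys ∎
    where
    open ≡-Reasoning
    C : ℕ
    C = countB (map (_<ᵇ c) l)
    below-c : countB (map (_<ᵇ c) (l ++ ys)) ≡ C + length ys
    below-c = trans (cong countB (map-++ (_<ᵇ c) l ys))
                    (trans (countB-++ (map (_<ᵇ c) l) (map (_<ᵇ c) ys))
                           (cong (C +_) (countB-map-true (All.map <ᵇ-true ys<c))))
    rearrange : ∀ C Y I J L → (C + Y) + (I + J + L * Y) ≡ (C + I) + J + suc L * Y
    rearrange = solve-∀

  insertions-↭ : ∀ a σ → All (_↭ a ∷ σ) (insertions a σ)
  insertions-↭ a []      = ↭-refl ∷ []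
  insertions-↭ a (b ∷ σ) =
    ↭-refl ∷ All.map⁺ (All.map (λ π↭aσ → ↭-trans (↭-prep b π↭aσ) (↭-swap b a ↭-refl)) (insertions-↭ a σ))

  perms-↭ : ∀ l → All (_↭ l) (perms l)
  perms-↭ []      = ↭-refl ∷ []
  perms-↭ (a ∷ l) = All.concat⁺ (All.map⁺ (All.map insert-a (perms-↭ l)))
    where
    insert-a : ∀ {σ} → σ ↭ l → All (_↭ a ∷ l) (insertions a σ)
    insert-a σ↭l = All.map (λ π↭aσ → ↭-trans π↭aσ (↭-prep a σ↭l)) (insertions-↭ a _)

  range1-sorted : ∀ n → AllPairs _<_ (range1 n)
  range1-sorted n = AllPairs.map⁺ (AllPairs.applyUpTo⁺₁ (λ i → i) n (λ i<j _ → s<s i<j))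

  range1-length : ∀ n → length (range1 n) ≡ n
  range1-length n = trans (length-map suc (upTo n)) (length-upTo n)

  Unique-resp-↭ : ∀ {xs ys} → xs ↭ ys → Unique xs → Unique ys
  Unique-resp-↭ xs↭ys = Permutationₛ.Unique-resp-↭ (setoid ℕ) (↭⇒↭ₛ xs↭ys)

module WeightedSums {c ℓ : Level} (R : CommutativeSemiring c ℓ) where
  open import Data.Nat as ℕ using (_<_)
  open import Data.Nat.Properties using (<-trans; <⇒≢) renaming (*-identityʳ to *-identityʳℕ)
  open import Data.Nat.Tactic.RingSolver using (solve-∀)
  open import Data.Bool using (Bool; true; false; if_then_else_; T?)
  open import Data.List using (List; []; _∷_; _++_; map; foldr; length; concatMap; filter)
  open import Data.List.Relation.Unary.All as All using (All; []; _∷_)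
  open import Data.List.Relation.Unary.AllPairs as AllPairs using (AllPairs; _∷_)
  open import Data.List.Relation.Unary.Unique.Propositional using (Unique)
  open import Data.List.Relation.Binary.Permutation.Propositional using (_↭_; ↭-sym)
  open import Data.List.Relation.Binary.Permutation.Propositional.Properties
    using (All-resp-↭; ↭-length; ¬x∷xs↭[])
  open import Function using (_∘_)
  open import Relation.Nullary using (contradiction)
  open import Relation.Binary.PropositionalEquality as ≡ using (_≡_)
  import Relation.Binary.Reasoning.Setoid as SetoidReasoning
  import Algebra.Properties.CommutativeSemigroup as CommutativeSemigroupProperties
  open Patterns
  open CommutativeSemiring R
  open SetoidReasoning setoid
  open import Algebra.Solver.CommutativeMonoid *-commutativeMonoid using (solve; _⊕_; _⊜_)

  ∑ : {A : Set} → (A → Carrier) → List A → Carrier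
  ∑ f = foldr (λ a r → f a + r) 0#

  ∑-++ : ∀ {A : Set} (f : A → Carrier) xs ys → ∑ f (xs ++ ys) ≈ ∑ f xs + ∑ f ys
  ∑-++ f []       ys = sym (+-identityˡ _)
  ∑-++ f (a ∷ xs) ys = trans (+-congˡ (∑-++ f xs ys)) (sym (+-assoc _ _ _))

  ∑-concatMap : ∀ {A B : Set} (f : B → Carrier) (g : A → List B) xs →
    ∑ f (concatMap g xs) ≈ ∑ (∑ f ∘ g) xs
  ∑-concatMap f g []       = refl
  ∑-concatMap f g (a ∷ xs) = trans (∑-++ f (g a) (concatMap g xs)) (+-congˡ (∑-concatMap f g xs))

  ∑-map : ∀ {A B : Set} (f : B → Carrier) (g : A → B) xs → ∑ f (map g xs) ≡ ∑ (f ∘ g) xs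
  ∑-map f g []       = ≡.refl
  ∑-map f g (a ∷ xs) = ≡.cong (f (g a) +_) (∑-map f g xs)

  ∑-cong : ∀ {A : Set} {f g : A → Carrier} {xs} → All (λ a → f a ≈ g a) xs → ∑ f xs ≈ ∑ g xs
  ∑-cong []           = refl
  ∑-cong (fa≈ga ∷ eqs) = +-cong fa≈ga (∑-cong eqs)

  ∑-+ : ∀ {A : Set} (f g : A → Carrier) xs → ∑ (λ a → f a + g a) xs ≈ ∑ f xs + ∑ g xs
  ∑-+ f g []       = sym (+-identityʳ 0#)
  ∑-+ f g (a ∷ xs) = trans (+-congˡ (∑-+ f g xs)) (interchange (f a) (g a) (∑ f xs) (∑ g xs))
    where open CommutativeSemigroupProperties +-commutativeSemigroup using (interchange)

  ∑-*ˡ : ∀ {A : Set} k (f : A → Carrier) xs → ∑ (λ a → k * f a) xs ≈ k * ∑ f xs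
  ∑-*ˡ k f []       = sym (zeroʳ k)
  ∑-*ˡ k f (a ∷ xs) = trans (+-congˡ (∑-*ˡ k f xs)) (sym (distribˡ k _ _))

  ∑-filter : ∀ {A : Set} (p : A → Bool) (f : A → Carrier) xs →
    ∑ f (filter (T? ∘ p) xs) ≈ ∑ (λ a → if p a then f a else 0#) xs
  ∑-filter p f []       = refl
  ∑-filter p f (a ∷ xs) with p a
  ... | true  = +-congˡ (∑-filter p f xs)
  ... | false = trans (∑-filter p f xs) (sym (+-identityˡ _))

  pow-+ : ∀ z m n → pow R z (m ℕ.+ n) ≈ pow R z m * pow R z n
  pow-+ z ℕ.zero    n = sym (*-identityˡ _)
  pow-+ z (ℕ.suc m) n = trans (*-congˡ (pow-+ z m n)) (sym (*-assoc _ _ _))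

  SupportedOnAvoiders : (List ℕ → Carrier) → Set ℓ
  SupportedOnAvoiders f = ∀ w → avoids w ≡ false → f w ≈ 0#

  supported-∷ : ∀ {f} u → SupportedOnAvoiders f → SupportedOnAvoiders (f ∘ (u ∷_))
  supported-∷ u f-supp w w✗ = f-supp (u ∷ w) (avoids-∷-false u w w✗)

  -- Inserting the smallest entry anywhere but last or next-to-last creates a 123 or 132.
  ∑-insertions-smallest : ∀ {f a u} r → SupportedOnAvoiders f → a < u → All (a <_) r → Unique (u ∷ r) →
    ∑ f (insertions a (u ∷ r)) ≈ f ((u ∷ r) ++ a ∷ []) + f (insertBeforeLast a (u ∷ r))
  ∑-insertions-smallest []      _ _ _ _ = trans (+-congˡ (+-identityʳ _)) (+-comm _ _)
  ∑-insertions-smallest {f} {a} {u} (v ∷ r) f-supp a<u (a<v ∷ a<r) ((u≢v ∷ _) ∷ unique-vr) = begin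
    f (a ∷ u ∷ v ∷ r) + ∑ f (map (u ∷_) (insertions a (v ∷ r)))
      ≈⟨ +-cong (f-supp _ (avoids-123-or-132 r a<u a<v u≢v))
                (reflexive (∑-map f (u ∷_) (insertions a (v ∷ r)))) ⟩
    0# + ∑ (f ∘ (u ∷_)) (insertions a (v ∷ r))
      ≈⟨ +-identityˡ _ ⟩
    ∑ (f ∘ (u ∷_)) (insertions a (v ∷ r))
      ≈⟨ ∑-insertions-smallest r (supported-∷ u f-supp) a<v a<r unique-vr ⟩
    f ((u ∷ v ∷ r) ++ a ∷ []) + f (insertBeforeLast a (u ∷ v ∷ r)) ∎

  ∑-insertions-beforeLast : ∀ {f a b} τ → SupportedOnAvoiders f → a < b → All (b <_) τ →
    ∑ (f ∘ insertBeforeLast a) (insertions b τ) ≈ f (τ ++ a ∷ b ∷ [])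
  ∑-insertions-beforeLast []      _ _ _ = +-identityʳ _
  ∑-insertions-beforeLast {f} {a} {b} (u ∷ τ) f-supp a<b (b<u ∷ b<τ) = begin
    f (b ∷ insertBeforeLast a (u ∷ τ)) + ∑ (f ∘ insertBeforeLast a) (map (u ∷_) (insertions b τ))
      ≈⟨ +-cong (f-supp _ (avoids-insertBeforeLast τ a<b (b<u ∷ b<τ)))
                (reflexive (∑-map (f ∘ insertBeforeLast a) (u ∷_) (insertions b τ))) ⟩
    0# + ∑ (λ σ → f (insertBeforeLast a (u ∷ σ))) (insertions b τ)
      ≈⟨ +-identityˡ _ ⟩
    ∑ (λ σ → f (insertBeforeLast a (u ∷ σ))) (insertions b τ)
      ≈⟨ ∑-cong (All.map insertBeforeLast-∷ (insertions-↭ b τ)) ⟩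
    ∑ (f ∘ (u ∷_) ∘ insertBeforeLast a) (insertions b τ)
      ≈⟨ ∑-insertions-beforeLast τ (supported-∷ u f-supp) a<b b<τ ⟩
    f ((u ∷ τ) ++ a ∷ b ∷ []) ∎
    where
    insertBeforeLast-∷ : ∀ {σ} → σ ↭ b ∷ τ →
      f (insertBeforeLast a (u ∷ σ)) ≈ f (u ∷ insertBeforeLast a σ)
    insertBeforeLast-∷ {[]}    []↭bτ = contradiction (↭-sym []↭bτ) ¬x∷xs↭[]
    insertBeforeLast-∷ {_ ∷ _} _     = refl

  module _ (x y q : Carrier) where

    weight : List ℕ → Carrier
    weight π = (pow R x (s π) * pow R y (d π)) * pow R q (inv π)

    avoidingWeight : List ℕ → Carrier
    avoidingWeight π = if avoids π then weight π else 0#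

    avoidingWeight-supported : SupportedOnAvoiders avoidingWeight
    avoidingWeight-supported w w✗ rewrite w✗ = refl

    weight-++ : ∀ xs ys → xs ≻ ys →
      weight (xs ++ ys) ≈ (weight xs * weight ys) * pow R q (length xs ℕ.* length ys)
    weight-++ xs ys xs≻ys
      rewrite s-++ xs ys xs≻ys | d-++ xs ys xs≻ys | inv-++ xs ys xs≻ys = begin
      (pow R x (s xs ℕ.+ s ys) * pow R y (d xs ℕ.+ d ys)) * pow R q (inv xs ℕ.+ inv ys ℕ.+ n)
        ≈⟨ *-cong (*-cong (pow-+ x (s xs) (s ys)) (pow-+ y (d xs) (d ys)))
                  (trans (pow-+ q (inv xs ℕ.+ inv ys) n) (*-congʳ (pow-+ q (inv xs) (inv ys)))) ⟩
      ((xˢ * xˢ′) * (yᵈ * yᵈ′)) * ((qⁱ * qⁱ′) * qⁿ)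
        ≈⟨ solve 7 (λ a a′ b b′ c c′ e → ((a ⊕ a′) ⊕ (b ⊕ b′)) ⊕ ((c ⊕ c′) ⊕ e)
                                         ⊜ (((a ⊕ b) ⊕ c) ⊕ ((a′ ⊕ b′) ⊕ c′)) ⊕ e)
                 refl xˢ xˢ′ yᵈ yᵈ′ qⁱ qⁱ′ qⁿ ⟩
      (((xˢ * yᵈ) * qⁱ) * ((xˢ′ * yᵈ′) * qⁱ′)) * qⁿ ∎
      where
      n : ℕ
      n = length xs ℕ.* length ys
      xˢ xˢ′ yᵈ yᵈ′ qⁱ qⁱ′ qⁿ : Carrier
      xˢ  = pow R x (s xs)
      xˢ′ = pow R x (s ys)
      yᵈ  = pow R y (d xs)
      yᵈ′ = pow R y (d ys)
      qⁱ  = pow R q (inv xs)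
      qⁱ′ = pow R q (inv ys)
      qⁿ  = pow R q n

    avoidingWeight-++ : ∀ xs ys → xs ≻ ys →
      avoidingWeight (xs ++ ys) ≈ (avoidingWeight xs * avoidingWeight ys) * pow R q (length xs ℕ.* length ys)
    avoidingWeight-++ xs ys xs≻ys rewrite avoids-++ xs xs≻ys with avoids xs | avoids ys
    ... | true  | true  = weight-++ xs ys xs≻ys
    ... | true  | false = sym (trans (*-congʳ (zeroʳ _)) (zeroˡ _))
    ... | false | _     = sym (trans (*-congʳ (zeroˡ _)) (zeroˡ _))

    avoidingWeight-singleton : ∀ a → avoidingWeight (a ∷ []) ≈ x
    avoidingWeight-singleton a = trans (*-identityʳ _) (trans (*-identityʳ _) (*-identityʳ x))

    avoidingWeight-ascent : ∀ {a b} → a < b → avoidingWeight (a ∷ b ∷ []) ≈ y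
    avoidingWeight-ascent {a} {b} a<b rewrite <ᵇ-true a<b | <ᵇ-false a<b =
      trans (*-identityʳ _) (trans (*-identityˡ _) (*-identityʳ y))

    avoidingWeight-append-singleton : ∀ {a} σ → All (a <_) σ →
      avoidingWeight (σ ++ a ∷ []) ≈ (x * pow R q (length σ)) * avoidingWeight σ
    avoidingWeight-append-singleton {a} σ a<σ = begin
      avoidingWeight (σ ++ a ∷ [])
        ≈⟨ avoidingWeight-++ σ (a ∷ []) (All.map (_∷ []) a<σ) ⟩
      (avoidingWeight σ * avoidingWeight (a ∷ [])) * pow R q (length σ ℕ.* 1)
        ≈⟨ *-cong (*-congˡ (avoidingWeight-singleton a))
                  (reflexive (≡.cong (pow R q) (*-identityʳℕ (length σ)))) ⟩
      (avoidingWeight σ * x) * pow R q (length σ)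
        ≈⟨ solve 3 (λ w x′ qⁿ → (w ⊕ x′) ⊕ qⁿ ⊜ (x′ ⊕ qⁿ) ⊕ w) refl
                 (avoidingWeight σ) x (pow R q (length σ)) ⟩
      (x * pow R q (length σ)) * avoidingWeight σ ∎

    avoidingWeight-append-ascent : ∀ {a b} τ → a < b → All (b <_) τ →
      avoidingWeight (τ ++ a ∷ b ∷ []) ≈ (y * pow R q (length τ ℕ.+ length τ)) * avoidingWeight τ
    avoidingWeight-append-ascent {a} {b} τ a<b b<τ = begin
      avoidingWeight (τ ++ a ∷ b ∷ [])
        ≈⟨ avoidingWeight-++ τ (a ∷ b ∷ []) (All.map (λ b<u → <-trans a<b b<u ∷ b<u ∷ []) b<τ) ⟩
      (avoidingWeight τ * avoidingWeight (a ∷ b ∷ [])) * pow R q (length τ ℕ.* 2)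
        ≈⟨ *-cong (*-congˡ (avoidingWeight-ascent a<b)) (reflexive (≡.cong (pow R q) (*2 (length τ)))) ⟩
      (avoidingWeight τ * y) * pow R q (length τ ℕ.+ length τ)
        ≈⟨ solve 3 (λ w y′ qⁿ → (w ⊕ y′) ⊕ qⁿ ⊜ (y′ ⊕ qⁿ) ⊕ w) refl
                 (avoidingWeight τ) y (pow R q (length τ ℕ.+ length τ)) ⟩
      (y * pow R q (length τ ℕ.+ length τ)) * avoidingWeight τ ∎
      where
      *2 : ∀ n → n ℕ.* 2 ≡ n ℕ.+ n
      *2 = solve-∀

    ∑-insertions-two-smallest : ∀ {a b} τ → a < b → All (b <_) τ → Unique τ →
      ∑ (∑ avoidingWeight ∘ insertions a) (insertions b τ)
        ≈ (x * pow R q (ℕ.suc (length τ))) * ∑ avoidingWeight (insertions b τ)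
          + (y * pow R q (length τ ℕ.+ length τ)) * avoidingWeight τ
    ∑-insertions-two-smallest {a} {b} τ a<b b<τ unique-τ = begin
      ∑ (∑ avoidingWeight ∘ insertions a) (insertions b τ)
        ≈⟨ ∑-cong (All.map insert-a (insertions-↭ b τ)) ⟩
      ∑ (λ σ → xqⁿ * avoidingWeight σ + avoidingWeight (insertBeforeLast a σ)) (insertions b τ)
        ≈⟨ ∑-+ (λ σ → xqⁿ * avoidingWeight σ) (avoidingWeight ∘ insertBeforeLast a) (insertions b τ) ⟩
      ∑ (λ σ → xqⁿ * avoidingWeight σ) (insertions b τ)
        + ∑ (avoidingWeight ∘ insertBeforeLast a) (insertions b τ)
        ≈⟨ +-cong (∑-*ˡ xqⁿ avoidingWeight (insertions b τ))
                  (trans (∑-insertions-beforeLast τ avoidingWeight-supported a<b b<τ)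
                         (avoidingWeight-append-ascent τ a<b b<τ)) ⟩
      xqⁿ * ∑ avoidingWeight (insertions b τ) + (y * pow R q (length τ ℕ.+ length τ)) * avoidingWeight τ ∎
      where
      xqⁿ : Carrier
      xqⁿ = x * pow R q (ℕ.suc (length τ))
      a<bτ : All (a <_) (b ∷ τ)
      a<bτ = a<b ∷ All.map (<-trans a<b) b<τ
      unique-bτ : Unique (b ∷ τ)
      unique-bτ = All.map <⇒≢ b<τ ∷ unique-τ
      insert-a : ∀ {σ} → σ ↭ b ∷ τ →
        ∑ avoidingWeight (insertions a σ) ≈ xqⁿ * avoidingWeight σ + avoidingWeight (insertBeforeLast a σ)
      insert-a {[]}    []↭bτ = contradiction (↭-sym []↭bτ) ¬x∷xs↭[]
      insert-a {u ∷ r} σ↭bτ = trans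
        (∑-insertions-smallest r avoidingWeight-supported (All.head a<σ) (All.tail a<σ)
                               (Unique-resp-↭ (↭-sym σ↭bτ) unique-bτ))
        (+-congʳ (trans (avoidingWeight-append-singleton (u ∷ r) a<σ)
                        (reflexive (≡.cong (λ n → (x * pow R q n) * avoidingWeight (u ∷ r)) (↭-length σ↭bτ)))))
        where
        a<σ : All (a <_) (u ∷ r)
        a<σ = All-resp-↭ (↭-sym σ↭bτ) a<bτ

    ∑-perms-two-smallest : ∀ a b rest → AllPairs _<_ (a ∷ b ∷ rest) →
      ∑ avoidingWeight (perms (a ∷ b ∷ rest))
        ≈ (x * pow R q (ℕ.suc (length rest))) * ∑ avoidingWeight (perms (b ∷ rest))
          + (y * pow R q (length rest ℕ.+ length rest)) * ∑ avoidingWeight (perms rest)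
    ∑-perms-two-smallest a b rest ((a<b ∷ _) ∷ b<rest ∷ sorted-rest) = begin
      ∑ avoidingWeight (concatMap (insertions a) (concatMap (insertions b) (perms rest)))
        ≈⟨ ∑-concatMap avoidingWeight (insertions a) (concatMap (insertions b) (perms rest)) ⟩
      ∑ (∑ avoidingWeight ∘ insertions a) (concatMap (insertions b) (perms rest))
        ≈⟨ ∑-concatMap (∑ avoidingWeight ∘ insertions a) (insertions b) (perms rest) ⟩
      ∑ (∑ (∑ avoidingWeight ∘ insertions a) ∘ insertions b) (perms rest)
        ≈⟨ ∑-cong (All.map insert-b-a (perms-↭ rest)) ⟩
      ∑ (λ τ → xqⁿ * ∑ avoidingWeight (insertions b τ) + yqⁿ * avoidingWeight τ) (perms rest)
        ≈⟨ ∑-+ (λ τ → xqⁿ * ∑ avoidingWeight (insertions b τ)) (λ τ → yqⁿ * avoidingWeight τ) (perms rest) ⟩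
      ∑ (λ τ → xqⁿ * ∑ avoidingWeight (insertions b τ)) (perms rest)
        + ∑ (λ τ → yqⁿ * avoidingWeight τ) (perms rest)
        ≈⟨ +-cong (trans (∑-*ˡ xqⁿ (∑ avoidingWeight ∘ insertions b) (perms rest))
                         (*-congˡ (sym (∑-concatMap avoidingWeight (insertions b) (perms rest)))))
                  (∑-*ˡ yqⁿ avoidingWeight (perms rest)) ⟩
      xqⁿ * ∑ avoidingWeight (perms (b ∷ rest)) + yqⁿ * ∑ avoidingWeight (perms rest) ∎
      where
      xqⁿ yqⁿ : Carrier
      xqⁿ = x * pow R q (ℕ.suc (length rest))
      yqⁿ = y * pow R q (length rest ℕ.+ length rest)
      insert-b-a : ∀ {τ} → τ ↭ rest →
        ∑ (∑ avoidingWeight ∘ insertions a) (insertions b τ)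
          ≈ xqⁿ * ∑ avoidingWeight (insertions b τ) + yqⁿ * avoidingWeight τ
      insert-b-a {τ} τ↭rest =
        ≡.subst (λ n → ∑ (∑ avoidingWeight ∘ insertions a) (insertions b τ)
                         ≈ (x * pow R q (ℕ.suc n)) * ∑ avoidingWeight (insertions b τ)
                           + (y * pow R q (n ℕ.+ n)) * avoidingWeight τ)
                (↭-length τ↭rest)
                (∑-insertions-two-smallest τ a<b (All-resp-↭ (↭-sym τ↭rest) b<rest)
                   (Unique-resp-↭ (↭-sym τ↭rest) (AllPairs.map <⇒≢ sorted-rest)))

    Frec : ℕ → Carrier
    Frec 0                 = 1#
    Frec 1                 = x
    Frec (ℕ.suc (ℕ.suc m)) =
      (x * pow R q (ℕ.suc m)) * Frec (ℕ.suc m) + (y * pow R q (m ℕ.+ m)) * Frec m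

    ∑-perms-sorted : ∀ l → AllPairs _<_ l → ∑ avoidingWeight (perms l) ≈ Frec (length l)
    ∑-perms-sorted []              _ = trans (+-identityʳ _) (trans (*-identityʳ _) (*-identityʳ 1#))
    ∑-perms-sorted (a ∷ [])        _ = trans (+-identityʳ _) (avoidingWeight-singleton a)
    ∑-perms-sorted (a ∷ b ∷ rest) sorted@(_ ∷ sorted-brest@(_ ∷ sorted-rest)) =
      trans (∑-perms-two-smallest a b rest sorted)
            (+-cong (*-congˡ (∑-perms-sorted (b ∷ rest) sorted-brest))
                    (*-congˡ (∑-perms-sorted rest sorted-rest)))

    F≈Frec : ∀ n → F R x y q n ≈ Frec n
    F≈Frec n = begin
      F R x y q n                          ≈⟨ ∑-filter avoids weight (Sn n) ⟩
      ∑ avoidingWeight (perms (range1 n))  ≈⟨ ∑-perms-sorted (range1 n) (range1-sorted n) ⟩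
      Frec (length (range1 n))             ≡⟨ ≡.cong Frec (range1-length n) ⟩
      Frec n                               ∎

theorem2p1 : {c ℓ : Level} (R : CommutativeSemiring c ℓ) →
    let open CommutativeSemiring R in
    (x y q : Carrier) →
      (F R x y q 0 ≈ 1#)
      × (F R x y q 1 ≈ x)
      × ((m : ℕ) → F R x y q (suc (suc m))
           ≈ ((x * pow R q (suc m)) * F R x y q (suc m))
             + ((y * pow R q (Data.Nat._+_ m m)) * F R x y q m))
theorem2p1 R x y q =
  F≈Frec x y q 0 , F≈Frec x y q 1 , λ m →
    trans (F≈Frec x y q (suc (suc m)))
          (sym (+-cong (*-congˡ (F≈Frec x y q (suc m))) (*-congˡ (F≈Frec x y q m))))
  where
  open CommutativeSemiring R
  open WeightedSums R using (F≈Frec)
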